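{- Let $t_n$ (the number of tree-like polyhexes with $n+1$ hexagons) be defined by $t_0=t_1=1$ and $(n+1)t_n=3(2n-1)t_{n-1}-5(n-2)t_{n-2}$ for $n\geq 2$. The sequence $\{t_n\}_{n\geq 2}$ is ratio log-concave, and the sequence $\{\sqrt[n]{t_n}\}_{n\geq 1}$ is strictly log-concave.
   Context: A sequence $(x_n)_{n\ge m}$ of positive reals is log-concave if $x_n^2\ge x_{n-1}x_{n+1}$ for all $n\ge m+1$, strictly log-concave if the inequality is strict. A sequence $(a_n)_{n\ge m}$ of positive reals is ratio log-concave if $(a_{n+1}/a_n)_{n\ge m}$ is log-concave. -}

module Defs where

open import Data.Nat as ℕ using (ℕ; zero; suc)
open import Data.Integer as ℤ using (ℤ)
open import Data.Rational
open import Data.Rational.Properties using (_≟_)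
open import Data.Product using (_×_)
open import Relation.Nullary using (yes; no)

-- Writing n = m + 2:  t (m+2) = (3(2m+3) t (m+1) - 5 m t m) / (m+3).
t : ℕ → ℚ
t zero = 1ℚ
t (suc zero) = 1ℚ
t (suc (suc m)) =
  ((ℤ.+ (3 ℕ.* (2 ℕ.* m ℕ.+ 3)) / 1) * t (suc m) - (ℤ.+ (5 ℕ.* m) / 1) * t m)
    * (ℤ.+ 1 / suc (suc (suc m)))

_^ℚ_ : ℚ → ℕ → ℚ
q ^ℚ zero = 1ℚ
q ^ℚ suc k = q * (q ^ℚ k)

-- division, total (value at a zero denominator is irrelevant: only used on positive sequences)
_÷?_ : ℚ → ℚ → ℚ
p ÷? q with q ≟ 0ℚ
... | yes _ = 0ℚ
... | no q≢0 = _÷_ p q {{≢-nonZero q≢0}}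

Positive-from : ℕ → (ℕ → ℚ) → Set
Positive-from m x = ∀ n → m ℕ.≤ n → 0ℚ < x n

LogConcave-from : ℕ → (ℕ → ℚ) → Set
LogConcave-from m x =
  Positive-from m x × (∀ n → suc m ℕ.≤ n → x (ℕ.pred n) * x (suc n) ≤ x n * x n)

RatioLogConcave-from : ℕ → (ℕ → ℚ) → Set
RatioLogConcave-from m a =
  Positive-from m a × LogConcave-from m (λ n → a (suc n) ÷? a n)

-- Strict log-concavity of (t_n^{1/n})_{n ≥ 1}, stated without real roots:
-- for positive t and n ≥ 2, (t_n^{1/n})^2 > t_{n-1}^{1/(n-1)} t_{n+1}^{1/(n+1)}
-- is equivalent (raising both sides to the power (n-1)n(n+1)) to
--   t_{n-1}^{n(n+1)} · t_{n+1}^{(n-1)n} < t_n^{2(n-1)(n+1)}.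
RootStrictlyLogConcave-from1 : (ℕ → ℚ) → Set
RootStrictlyLogConcave-from1 x =
  Positive-from 1 x ×
  (∀ n → 2 ℕ.≤ n →
     (x (ℕ.pred n) ^ℚ (n ℕ.* suc n)) * (x (suc n) ^ℚ (ℕ.pred n ℕ.* n))
       < x n ^ℚ (2 ℕ.* (ℕ.pred n ℕ.* suc n)))

{-
Write rₙ = tₙ₊₁/tₙ. For n = 15 + k the ratio rₙ is trapped between a(k)/d(k) and b(k)/d(k),
two rational functions of n that agree up to 80/n⁴. The recurrence carries the bounds from n
to n+1, and the bounds at n-1, n, n+1 force rₙ₋₁ rₙ₊₁ ≤ rₙ², because each of the three
polynomial inequalities involved has nonnegative coefficients as a polynomial in k; the cases
below 15 are computed. Strict log-concavity of tₙ^{1/n} then follows by induction on n: with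
denominators cleared, the inequality at n+1 is the inequality at n times the n(n+1)-th power of
the ratio inequality rₙ₋₁ rₙ₊₁ ≤ rₙ². Positivity comes from monotonicity of tₙ, which the
recurrence propagates from t₀ = t₁.
-}
module Submission where

open import Defs
open import Data.Product using (_×_)
open import Data.Product.Base using (_,_; proj₁; proj₂)

module Polynomial where

  open import Data.Bool.Base using (Bool; true; _∧_; T)
  open import Data.Bool.Properties using (T-∧)
  open import Data.List.Base using (List; []; _∷_)
  open import Data.Nat.Base
  open import Data.Nat.Properties
  open import Data.Nat.Tactic.RingSolver using (solve-∀)
  open import Function.Bundles using (Equivalence)
  open import Relation.Binary.PropositionalEquality

  Poly : Set
  Poly = List ℕ

  -- Opaque, because unfolding eval makes the conversion checker expand a literal such as
  -- 3694950 + x into millions of suc constructors.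
  opaque
    eval : Poly → ℕ → ℕ
    eval []      x = 0
    eval (c ∷ p) x = c + x * eval p x

  infixl 6 _⊕_
  infixl 7 _⊗_ _·_

  _⊕_ : Poly → Poly → Poly
  []      ⊕ q       = q
  (a ∷ p) ⊕ []      = a ∷ p
  (a ∷ p) ⊕ (b ∷ q) = a + b ∷ p ⊕ q

  _·_ : ℕ → Poly → Poly
  c · []      = []
  c · (a ∷ p) = c * a ∷ c · p

  _⊗_ : Poly → Poly → Poly
  []      ⊗ q = []
  (a ∷ p) ⊗ q = a · q ⊕ (0 ∷ p ⊗ q)

  _∘ₚ_ : Poly → Poly → Poly
  []      ∘ₚ q = []
  (c ∷ p) ∘ₚ q = (c ∷ []) ⊕ q ⊗ (p ∘ₚ q)

  _≤ᵇ-coeffs_ : Poly → Poly → Bool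
  []      ≤ᵇ-coeffs q       = true
  (a ∷ p) ≤ᵇ-coeffs []      = (a ≡ᵇ 0) ∧ (p ≤ᵇ-coeffs [])
  (a ∷ p) ≤ᵇ-coeffs (b ∷ q) = (a ≤ᵇ b) ∧ (p ≤ᵇ-coeffs q)

  opaque
    unfolding eval
    eval-⊕ : ∀ p q x → eval (p ⊕ q) x ≡ eval p x + eval q x
    eval-⊕ []      q       x = refl
    eval-⊕ (a ∷ p) []      x = sym (+-identityʳ _)
    eval-⊕ (a ∷ p) (b ∷ q) x rewrite eval-⊕ p q x = rearrange a b x (eval p x) (eval q x)
      where
      rearrange : ∀ a b x u v → a + b + x * (u + v) ≡ a + x * u + (b + x * v)
      rearrange = solve-∀

    eval-· : ∀ c p x → eval (c · p) x ≡ c * eval p x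
    eval-· c []      x = sym (*-zeroʳ c)
    eval-· c (a ∷ p) x rewrite eval-· c p x = rearrange c a x (eval p x)
      where
      rearrange : ∀ c a x u → c * a + x * (c * u) ≡ c * (a + x * u)
      rearrange = solve-∀

    eval-⊗ : ∀ p q x → eval (p ⊗ q) x ≡ eval p x * eval q x
    eval-⊗ []      q x = refl
    eval-⊗ (a ∷ p) q x
      rewrite eval-⊕ (a · q) (0 ∷ p ⊗ q) x | eval-· a q x | eval-⊗ p q x
      = rearrange a x (eval p x) (eval q x)
      where
      rearrange : ∀ a x u v → a * v + (0 + x * (u * v)) ≡ (a + x * u) * v
      rearrange = solve-∀

    eval-constant : ∀ c x → eval (c ∷ []) x ≡ c
    eval-constant c x = trans (cong (c +_) (*-zeroʳ x)) (+-identityʳ c)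

    eval-identity : ∀ x → eval (0 ∷ 1 ∷ []) x ≡ x
    eval-identity x = trans (cong (x *_) (eval-constant 1 x)) (*-identityʳ x)

    eval-∘ : ∀ p q x → eval (p ∘ₚ q) x ≡ eval p (eval q x)
    eval-∘ []      q x = refl
    eval-∘ (c ∷ p) q x
      rewrite eval-⊕ (c ∷ []) (q ⊗ (p ∘ₚ q)) x | eval-⊗ q (p ∘ₚ q) x | eval-∘ p q x
      = cong (_+ _) (eval-constant c x)

    eval-pos : ∀ c p x → 0 < eval (suc c ∷ p) x
    eval-pos c p x = s≤s z≤n

    eval-mono : ∀ p q → T (p ≤ᵇ-coeffs q) → ∀ x → eval p x ≤ eval q x
    eval-mono []      q       _ x = z≤n
    eval-mono (a ∷ p) []      h x with Equivalence.to T-∧ h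
    ... | a≡0 , p≤0 rewrite ≡ᵇ⇒≡ a 0 a≡0 = ≤-trans (*-monoʳ-≤ x (eval-mono p [] p≤0 x)) (≤-reflexive (*-zeroʳ x))
    eval-mono (a ∷ p) (b ∷ q) h x with Equivalence.to T-∧ h
    ... | a≤b , p≤q = +-mono-≤ (≤ᵇ⇒≤ a b a≤b) (*-monoʳ-≤ x (eval-mono p q p≤q x))

  infixl 6 _:+_
  infixl 7 _:*_

  data Expr : Set where
    var  : Expr
    con  : ℕ → Expr
    poly : Poly → Expr → Expr
    cast : Expr → Expr
    _:+_ _:*_ : Expr → Expr → Expr

  ⟦_⟧ : Expr → ℕ → ℕ
  ⟦ var ⟧      x = x
  ⟦ con c ⟧    x = c
  ⟦ poly p e ⟧ x = eval p (⟦ e ⟧ x)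
  ⟦ cast e ⟧   x = ⟦ e ⟧ x
  ⟦ e :+ f ⟧   x = ⟦ e ⟧ x + ⟦ f ⟧ x
  ⟦ e :* f ⟧   x = ⟦ e ⟧ x * ⟦ f ⟧ x

  norm : Expr → Poly
  norm var        = 0 ∷ 1 ∷ []
  norm (con c)    = c ∷ []
  norm (poly p e) = p ∘ₚ norm e
  norm (cast e)   = norm e
  norm (e :+ f)   = norm e ⊕ norm f
  norm (e :* f)   = norm e ⊗ norm f

  eval-norm : ∀ e x → eval (norm e) x ≡ ⟦ e ⟧ x
  eval-norm var x = eval-identity x
  eval-norm (con c) x = eval-constant c x
  eval-norm (poly p e) x = trans (eval-∘ p (norm e) x) (cong (eval p) (eval-norm e x))
  eval-norm (cast e) x = eval-norm e x
  eval-norm (e :+ f) x = trans (eval-⊕ (norm e) (norm f) x) (cong₂ _+_ (eval-norm e x) (eval-norm f x))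
  eval-norm (e :* f) x = trans (eval-⊗ (norm e) (norm f) x) (cong₂ _*_ (eval-norm e x) (eval-norm f x))

  ⟦⟧-mono : ∀ e f → T (norm e ≤ᵇ-coeffs norm f) → ∀ x → ⟦ e ⟧ x ≤ ⟦ f ⟧ x
  ⟦⟧-mono e f h x =
    subst₂ _≤_ (eval-norm e x) (eval-norm f x) (eval-mono (norm e) (norm f) h x)


open Polynomial

open import Data.Bool.Base using (T)
open import Data.Integer.Base as ℤ using (+_)
import Data.Integer.Properties as ℤ
open import Data.List.Base using ([]; _∷_)
open import Data.Maybe.Base using (Maybe; just; nothing)
open import Data.Nat.Base as ℕ using (ℕ; zero; suc; z≤n; s≤s)
import Data.Nat.Coprimality as Coprime
import Data.Nat.Properties as ℕ
import Data.Nat.Tactic.RingSolver as ℕ-Ring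
open import Data.Rational
open import Data.Rational.Properties
open import Level using (0ℓ)
open import Relation.Binary.PropositionalEquality
open import Relation.Nullary using (yes; no; contradiction)
open import Relation.Nullary.Decidable using (True; toWitness; from-yes)
import Tactic.RingSolver.Core.AlmostCommutativeRing as ACR
open import Tactic.RingSolver using (solve-∀; solve)

ℚ-ring : ACR.AlmostCommutativeRing 0ℓ 0ℓ
ℚ-ring = ACR.fromCommutativeRing +-*-commutativeRing is-zero
  where
  is-zero : ∀ p → Maybe (0ℚ ≡ p)
  is-zero p with 0ℚ ≟ p
  ... | yes 0≡p = just 0≡p
  ... | no  _   = nothing

ι : ℕ → ℚ
ι n = + n / 1

ι-mkℚ : ∀ n → ι n ≡ mkℚ (+ n) 0 (Coprime.sym (Coprime.1-coprimeTo n))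
ι-mkℚ n = normalize-coprime (Coprime.sym (Coprime.1-coprimeTo n))

ι-+ : ∀ m n → ι (m ℕ.+ n) ≡ ι m + ι n
ι-+ m n rewrite ι-mkℚ m | ι-mkℚ n | ℕ.*-identityʳ m | ℕ.*-identityʳ n
              | ℤ.+◃n≡+n m | ℤ.+◃n≡+n n = refl

ι-* : ∀ m n → ι (m ℕ.* n) ≡ ι m * ι n
ι-* m n rewrite ι-mkℚ m | ι-mkℚ n = cong (_/ 1) (ℤ.pos-* m n)

ι-nonNeg : ∀ n → 0ℚ ≤ ι n
ι-nonNeg n = nonNegative⁻¹ (ι n) {{normalize-nonNeg n 1}}

ι-pos : ∀ n → 0 ℕ.< n → 0ℚ < ι n
ι-pos (suc n) _ = positive⁻¹ (ι (suc n)) {{normalize-pos (suc n) 1}}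

ι-mono : ∀ {m n} → m ℕ.≤ n → ι m ≤ ι n
ι-mono {m} {n} m≤n rewrite ι-mkℚ m | ι-mkℚ n = *≤* (ℤ.*-monoʳ-≤-nonNeg (+ 1) (ℤ.+≤+ m≤n))

ι-inverse : ∀ n → ι (suc n) * (+ 1 / suc n) ≡ 1ℚ
ι-inverse n = trans (cong₂ _*_ (ι-mkℚ (suc n)) (↥p/↧p≡p (mkℚ (+ 1) n (Coprime.1-coprimeTo (suc n)))))
                   (*-inverseʳ (mkℚ (+ suc n) 0 (Coprime.sym (Coprime.1-coprimeTo (suc n)))))

private
  variable
    p q r s : ℚ

*-pos : 0ℚ < p → 0ℚ < q → 0ℚ < p * q
*-pos {p} {q} p>0 q>0 = positive⁻¹ (p * q) {{pos*pos⇒pos p {{positive p>0}} q {{positive q>0}}}}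

*-nonNeg : 0ℚ ≤ p → 0ℚ ≤ q → 0ℚ ≤ p * q
*-nonNeg {p} {q} p≥0 q≥0 =
  nonNegative⁻¹ (p * q) {{nonNeg*nonNeg⇒nonNeg p {{nonNegative p≥0}} q {{nonNegative q≥0}}}}

*-monoˡ-≤-nonNeg′ : 0ℚ ≤ r → p ≤ q → r * p ≤ r * q
*-monoˡ-≤-nonNeg′ {r} r≥0 = *-monoˡ-≤-nonNeg r {{nonNegative r≥0}}

*-monoʳ-≤-nonNeg′ : 0ℚ ≤ r → p ≤ q → p * r ≤ q * r
*-monoʳ-≤-nonNeg′ {r} r≥0 = *-monoʳ-≤-nonNeg r {{nonNegative r≥0}}

*-mono-≤-nonNeg : 0ℚ ≤ p → 0ℚ ≤ r → p ≤ q → r ≤ s → p * r ≤ q * s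
*-mono-≤-nonNeg p≥0 r≥0 p≤q r≤s =
  ≤-trans (*-monoʳ-≤-nonNeg′ r≥0 p≤q) (*-monoˡ-≤-nonNeg′ (≤-trans p≥0 p≤q) r≤s)

*-monoʳ-<-pos′ : 0ℚ < r → p < q → r * p < r * q
*-monoʳ-<-pos′ {r} r>0 = *-monoʳ-<-pos r {{positive r>0}}

*-cancelˡ-≤-pos′ : 0ℚ < r → r * p ≤ r * q → p ≤ q
*-cancelˡ-≤-pos′ {r} r>0 = *-cancelˡ-≤-pos r {{positive r>0}}

*-cancelˡ-<-nonNeg′ : 0ℚ ≤ r → r * p < r * q → p < q
*-cancelˡ-<-nonNeg′ {r} r≥0 = *-cancelˡ-<-nonNeg r {{nonNegative r≥0}}

+-cancelʳ-≤ : ∀ r → p + r ≤ q + r → p ≤ q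
+-cancelʳ-≤ {p} {q} r p+r≤q+r =
  subst₂ _≤_ (x+y-y≡x p r) (x+y-y≡x q r) (+-monoˡ-≤ (- r) p+r≤q+r)
  where
  x+y-y≡x : ∀ x y → x + y - y ≡ x
  x+y-y≡x = solve-∀ ℚ-ring

^ℚ-+ : ∀ x m n → x ^ℚ (m ℕ.+ n) ≡ x ^ℚ m * x ^ℚ n
^ℚ-+ x zero    n = sym (*-identityˡ (x ^ℚ n))
^ℚ-+ x (suc m) n = trans (cong (x *_) (^ℚ-+ x m n)) (sym (*-assoc x (x ^ℚ m) (x ^ℚ n)))

^ℚ-distrib-* : ∀ x y n → (x * y) ^ℚ n ≡ x ^ℚ n * y ^ℚ n
^ℚ-distrib-* x y zero    = refl
^ℚ-distrib-* x y (suc n) = trans (cong (x * y *_) (^ℚ-distrib-* x y n)) (interchange x y (x ^ℚ n) (y ^ℚ n))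
  where
  interchange : ∀ a b c d → a * b * (c * d) ≡ a * c * (b * d)
  interchange = solve-∀ ℚ-ring

^ℚ-pos : ∀ n → 0ℚ < p → 0ℚ < p ^ℚ n
^ℚ-pos zero    _   = positive⁻¹ 1ℚ
^ℚ-pos (suc n) p>0 = *-pos p>0 (^ℚ-pos n p>0)

^ℚ-nonNeg : ∀ n → 0ℚ ≤ p → 0ℚ ≤ p ^ℚ n
^ℚ-nonNeg zero    _   = nonNegative⁻¹ 1ℚ
^ℚ-nonNeg (suc n) p≥0 = *-nonNeg p≥0 (^ℚ-nonNeg n p≥0)

^ℚ-mono-≤ : ∀ n → 0ℚ ≤ p → p ≤ q → p ^ℚ n ≤ q ^ℚ n
^ℚ-mono-≤ zero    _   _   = ≤-refl
^ℚ-mono-≤ (suc n) p≥0 p≤q = *-mono-≤-nonNeg p≥0 (^ℚ-nonNeg n p≥0) p≤q (^ℚ-mono-≤ n p≥0 p≤q)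

÷?-*-cancel : 0ℚ < q → (p ÷? q) * q ≡ p
÷?-*-cancel {q} {p} q>0 with q ≟ 0ℚ
... | yes q≡0 = contradiction q>0 (<-irrefl (sym q≡0))
... | no  q≢0 = trans (*-assoc p _ q) (trans (cong (p *_) (*-inverseˡ q {{≢-nonZero q≢0}})) (*-identityʳ p))

÷?-pos : 0ℚ < p → 0ℚ < q → 0ℚ < p ÷? q
÷?-pos {p} {q} p>0 q>0 = *-cancelʳ-<-nonNeg q {{nonNegative (<⇒≤ q>0)}}
  (subst₂ _<_ (sym (*-zeroˡ q)) (sym (÷?-*-cancel q>0)) p>0)

^ℚ-cube-* : ∀ x w n → (x * x * x * w) ^ℚ n ≡ x ^ℚ (n ℕ.+ n ℕ.+ n) * w ^ℚ n
^ℚ-cube-* x w n = begin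
  (x * x * x * w) ^ℚ n                    ≡⟨ ^ℚ-distrib-* (x * x * x) w n ⟩
  (x * x * x) ^ℚ n * w ^ℚ n               ≡⟨ cong (_* w ^ℚ n) (^ℚ-distrib-* (x * x) x n) ⟩
  (x * x) ^ℚ n * x ^ℚ n * w ^ℚ n          ≡⟨ cong (λ u → u * x ^ℚ n * w ^ℚ n) (^ℚ-distrib-* x x n) ⟩
  x ^ℚ n * x ^ℚ n * x ^ℚ n * w ^ℚ n       ≡⟨ cong (λ u → u * x ^ℚ n * w ^ℚ n) (^ℚ-+ x n n) ⟨
  x ^ℚ (n ℕ.+ n) * x ^ℚ n * w ^ℚ n        ≡⟨ cong (_* w ^ℚ n) (^ℚ-+ x (n ℕ.+ n) n) ⟨
  x ^ℚ (n ℕ.+ n ℕ.+ n) * w ^ℚ n           ∎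
  where open ≡-Reasoning

-- cast matters only here: it keeps a natural-number subterm under a single ι, as in ι (3 ℕ.+ m).
⟦_⟧ℚ : Expr → ℕ → ℚ
⟦ e :+ f ⟧ℚ x = ⟦ e ⟧ℚ x + ⟦ f ⟧ℚ x
⟦ e :* f ⟧ℚ x = ⟦ e ⟧ℚ x * ⟦ f ⟧ℚ x
⟦ e ⟧ℚ      x = ι (⟦ e ⟧ x)

ι-⟦⟧ : ∀ e x → ι (⟦ e ⟧ x) ≡ ⟦ e ⟧ℚ x
ι-⟦⟧ (e :+ f) x = trans (ι-+ (⟦ e ⟧ x) (⟦ f ⟧ x)) (cong₂ _+_ (ι-⟦⟧ e x) (ι-⟦⟧ f x))
ι-⟦⟧ (e :* f) x = trans (ι-* (⟦ e ⟧ x) (⟦ f ⟧ x)) (cong₂ _*_ (ι-⟦⟧ e x) (ι-⟦⟧ f x))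
ι-⟦⟧ var        x = refl
ι-⟦⟧ (con _)    x = refl
ι-⟦⟧ (poly _ _) x = refl
ι-⟦⟧ (cast _)   x = refl

≤-by-coefficients : ∀ e f → {T (norm e ≤ᵇ-coeffs norm f)} → ∀ x → ⟦ e ⟧ℚ x ≤ ⟦ f ⟧ℚ x
≤-by-coefficients e f {e≤f} x = subst₂ _≤_ (ι-⟦⟧ e x) (ι-⟦⟧ f x) (ι-mono (⟦⟧-mono e f e≤f x))

≤-by-computation : ∀ {p q} → {True (p ≤? q)} → p ≤ q
≤-by-computation {p} {q} {p≤q} = toWitness p≤q

<-by-computation : ∀ {p q} → {True (p <? q)} → p < q
<-by-computation {p} {q} {p<q} = toWitness p<q

-- T₂/T₁ = (S − Q T₀/T₁)/P increases with T₁/T₀, so an upper (lower) bound B/A on T₁/T₀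
-- gives the upper (lower) bound D/G on T₂/T₁ as soon as the coefficient inequality holds.
module _ {P Q S T₀ T₁ T₂ : ℚ} (recurrence : P * T₂ + Q * T₀ ≡ S * T₁)
         (P>0 : 0ℚ < P) (Q≥0 : 0ℚ ≤ Q) (T₁≥0 : 0ℚ ≤ T₁) where

  weighted-recurrence : ∀ B G → P * B * (G * T₂) + G * Q * (B * T₀) ≡ G * B * S * T₁
  weighted-recurrence B G = begin
    P * B * (G * T₂) + G * Q * (B * T₀) ≡⟨ solve (P ∷ B ∷ G ∷ T₂ ∷ Q ∷ T₀ ∷ []) ℚ-ring ⟩
    G * B * (P * T₂ + Q * T₀)           ≡⟨ cong (G * B *_) recurrence ⟩
    G * B * (S * T₁)                    ≡⟨ solve (G ∷ B ∷ S ∷ T₁ ∷ []) ℚ-ring ⟩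
    G * B * S * T₁                      ∎
    where open ≡-Reasoning

  ratio-upper-step : ∀ {A B G D} → 0ℚ < B → 0ℚ ≤ G →
    G * B * S ≤ P * B * D + G * Q * A → A * T₁ ≤ B * T₀ → G * T₂ ≤ D * T₁
  ratio-upper-step {A} {B} {G} {D} B>0 G≥0 coefficients AT₁≤BT₀ =
    *-cancelˡ-≤-pos′ (*-pos P>0 B>0) (+-cancelʳ-≤ (G * Q * (A * T₁)) (begin
      P * B * (G * T₂) + G * Q * (A * T₁) ≤⟨ +-monoʳ-≤ (P * B * (G * T₂)) (*-monoˡ-≤-nonNeg′ (*-nonNeg G≥0 Q≥0) AT₁≤BT₀) ⟩
      P * B * (G * T₂) + G * Q * (B * T₀) ≡⟨ weighted-recurrence B G ⟩
      G * B * S * T₁                      ≤⟨ *-monoʳ-≤-nonNeg′ T₁≥0 coefficients ⟩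
      (P * B * D + G * Q * A) * T₁        ≡⟨ solve (P ∷ B ∷ D ∷ G ∷ Q ∷ A ∷ T₁ ∷ []) ℚ-ring ⟩
      P * B * (D * T₁) + G * Q * (A * T₁) ∎))
    where open ≤-Reasoning

  ratio-lower-step : ∀ {A B G D} → 0ℚ < B → 0ℚ ≤ G →
    P * B * D + G * Q * A ≤ G * B * S → B * T₀ ≤ A * T₁ → D * T₁ ≤ G * T₂
  ratio-lower-step {A} {B} {G} {D} B>0 G≥0 coefficients BT₀≤AT₁ =
    *-cancelˡ-≤-pos′ (*-pos P>0 B>0) (+-cancelʳ-≤ (G * Q * (A * T₁)) (begin
      P * B * (D * T₁) + G * Q * (A * T₁) ≡⟨ solve (P ∷ B ∷ D ∷ G ∷ Q ∷ A ∷ T₁ ∷ []) ℚ-ring ⟩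
      (P * B * D + G * Q * A) * T₁        ≤⟨ *-monoʳ-≤-nonNeg′ T₁≥0 coefficients ⟩
      G * B * S * T₁                      ≡⟨ weighted-recurrence B G ⟨
      P * B * (G * T₂) + G * Q * (B * T₀) ≤⟨ +-monoʳ-≤ (P * B * (G * T₂)) (*-monoˡ-≤-nonNeg′ (*-nonNeg G≥0 Q≥0) BT₀≤AT₁) ⟩
      P * B * (G * T₂) + G * Q * (A * T₁) ∎))
    where open ≤-Reasoning

module RatioBoundPropagation
  (x P Q S : ℕ → ℚ) (recurrence : ∀ m → P m * x (2 ℕ.+ m) + Q m * x m ≡ S m * x (1 ℕ.+ m))
  (P>0 : ∀ m → 0ℚ < P m) (Q≥0 : ∀ m → 0ℚ ≤ Q m)
  (n₀ : ℕ) (x≥0 : ∀ k → 0ℚ ≤ x (k ℕ.+ n₀)) where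

  ratio-lower-bound : ∀ (α δ : ℕ → ℚ) → (∀ k → 0ℚ < α k) → (∀ k → 0ℚ ≤ δ k) →
    (∀ k → P (k ℕ.+ n₀) * α k * α (suc k) + δ (suc k) * Q (k ℕ.+ n₀) * δ k ≤ δ (suc k) * α k * S (k ℕ.+ n₀)) →
    α 0 * x n₀ ≤ δ 0 * x (suc n₀) →
    ∀ k → α k * x (k ℕ.+ n₀) ≤ δ k * x (suc k ℕ.+ n₀)
  ratio-lower-bound α δ α>0 δ≥0 certificate base zero    = base
  ratio-lower-bound α δ α>0 δ≥0 certificate base (suc k) =
    ratio-lower-step {S = S (k ℕ.+ n₀)} {T₀ = x (k ℕ.+ n₀)}
      (recurrence (k ℕ.+ n₀)) (P>0 _) (Q≥0 _) (x≥0 (suc k)) (α>0 k) (δ≥0 (suc k)) (certificate k)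
      (ratio-lower-bound α δ α>0 δ≥0 certificate base k)

  ratio-upper-bound : ∀ (β δ : ℕ → ℚ) → (∀ k → 0ℚ < β k) → (∀ k → 0ℚ ≤ δ k) →
    (∀ k → δ (suc k) * β k * S (k ℕ.+ n₀) ≤ P (k ℕ.+ n₀) * β k * β (suc k) + δ (suc k) * Q (k ℕ.+ n₀) * δ k) →
    δ 0 * x (suc n₀) ≤ β 0 * x n₀ →
    ∀ k → δ k * x (suc k ℕ.+ n₀) ≤ β k * x (k ℕ.+ n₀)
  ratio-upper-bound β δ β>0 δ≥0 certificate base zero    = base
  ratio-upper-bound β δ β>0 δ≥0 certificate base (suc k) =
    ratio-upper-step {S = S (k ℕ.+ n₀)} {T₀ = x (k ℕ.+ n₀)}
      (recurrence (k ℕ.+ n₀)) (P>0 _) (Q≥0 _) (x≥0 (suc k)) (β>0 k) (δ≥0 (suc k)) (certificate k)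
      (ratio-upper-bound β δ β>0 δ≥0 certificate base k)

-- The denominator-free form of (xₙ₊₁/xₙ) (xₙ₊₃/xₙ₊₂) ≤ (xₙ₊₂/xₙ₊₁)².
RatioLogConcaveAt : (ℕ → ℚ) → ℕ → Set
RatioLogConcaveAt x n =
  x (1 ℕ.+ n) * x (1 ℕ.+ n) * x (1 ℕ.+ n) * x (3 ℕ.+ n) ≤ x (2 ℕ.+ n) * x (2 ℕ.+ n) * x (2 ℕ.+ n) * x n

ratio-log-concave-from-bounds : ∀ (x α β δ : ℕ → ℚ) n₀ →
  (∀ k → 0ℚ ≤ x (k ℕ.+ n₀)) → (∀ k → 0ℚ < α k) → (∀ k → 0ℚ < δ k) →
  (∀ k → α k * x (k ℕ.+ n₀) ≤ δ k * x (suc k ℕ.+ n₀)) →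
  (∀ k → δ k * x (suc k ℕ.+ n₀) ≤ β k * x (k ℕ.+ n₀)) →
  (∀ k → β k * β (2 ℕ.+ k) * (δ (1 ℕ.+ k) * δ (1 ℕ.+ k)) ≤ α (1 ℕ.+ k) * α (1 ℕ.+ k) * (δ k * δ (2 ℕ.+ k))) →
  ∀ k → RatioLogConcaveAt x (k ℕ.+ n₀)
ratio-log-concave-from-bounds x α β δ n₀ x≥0 α>0 δ>0 lower upper certificate k =
  *-cancelˡ-≤-pos′ (*-pos (*-pos (α>0 (1 ℕ.+ k)) (α>0 (1 ℕ.+ k))) (*-pos (δ>0 k) (δ>0 (2 ℕ.+ k)))) (begin
    Y * Y * (U * W) * (T₁ * T₁ * T₁ * T₃)       ≡⟨ regroup₁ Y U W T₁ T₃ ⟩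
    (U * T₁) * (W * T₃) * ((Y * T₁) * (Y * T₁)) ≤⟨ *-mono-≤-nonNeg (*-nonNeg UT₁≥0 WT₃≥0) (*-nonNeg YT₁≥0 YT₁≥0)
                                                     (*-mono-≤-nonNeg UT₁≥0 WT₃≥0 (upper k) (upper (2 ℕ.+ k)))
                                                     (*-mono-≤-nonNeg YT₁≥0 YT₁≥0 (lower (1 ℕ.+ k)) (lower (1 ℕ.+ k))) ⟩
    (V * T₀) * (X * T₂) * ((Z * T₂) * (Z * T₂)) ≡⟨ regroup₂ V T₀ X T₂ Z ⟩
    V * X * (Z * Z) * (T₂ * T₂ * T₂ * T₀)       ≤⟨ *-monoʳ-≤-nonNeg′ T₂³T₀≥0 (certificate k) ⟩
    Y * Y * (U * W) * (T₂ * T₂ * T₂ * T₀)       ∎)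
  where
  open ≤-Reasoning
  T₀ = x (k ℕ.+ n₀)
  T₁ = x (1 ℕ.+ k ℕ.+ n₀)
  T₂ = x (2 ℕ.+ k ℕ.+ n₀)
  T₃ = x (3 ℕ.+ k ℕ.+ n₀)
  U = δ k
  V = β k
  W = δ (2 ℕ.+ k)
  X = β (2 ℕ.+ k)
  Y = α (1 ℕ.+ k)
  Z = δ (1 ℕ.+ k)
  UT₁≥0 = *-nonNeg (<⇒≤ (δ>0 k)) (x≥0 (1 ℕ.+ k))
  WT₃≥0 = *-nonNeg (<⇒≤ (δ>0 (2 ℕ.+ k))) (x≥0 (3 ℕ.+ k))
  YT₁≥0 = *-nonNeg (<⇒≤ (α>0 (1 ℕ.+ k))) (x≥0 (1 ℕ.+ k))
  T₂³T₀≥0 = *-nonNeg (*-nonNeg (*-nonNeg (x≥0 (2 ℕ.+ k)) (x≥0 (2 ℕ.+ k))) (x≥0 (2 ℕ.+ k))) (x≥0 k)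
  regroup₁ : ∀ y u w p q → y * y * (u * w) * (p * p * p * q) ≡ (u * p) * (w * q) * ((y * p) * (y * p))
  regroup₁ = solve-∀ ℚ-ring
  regroup₂ : ∀ v p x q z → (v * p) * (x * q) * ((z * q) * (z * q)) ≡ v * x * (z * z) * (q * q * q * p)
  regroup₂ = solve-∀ ℚ-ring

ratio-log-concave-from-cubic : ∀ (x : ℕ → ℚ) n → 0ℚ < x n → 0ℚ < x (1 ℕ.+ n) → 0ℚ < x (2 ℕ.+ n) →
  RatioLogConcaveAt x n →
  (x (1 ℕ.+ n) ÷? x n) * (x (3 ℕ.+ n) ÷? x (2 ℕ.+ n)) ≤ (x (2 ℕ.+ n) ÷? x (1 ℕ.+ n)) * (x (2 ℕ.+ n) ÷? x (1 ℕ.+ n))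
ratio-log-concave-from-cubic x n T₀>0 T₁>0 T₂>0 cubic =
  *-cancelˡ-≤-pos′ (*-pos (*-pos T₀>0 T₂>0) (*-pos T₁>0 T₁>0)) (begin
    T₀ * T₂ * (T₁ * T₁) * (r₀ * r₂)       ≡⟨ regroup₁ T₀ T₁ T₂ r₀ r₂ ⟩
    (r₀ * T₀) * (r₂ * T₂) * T₁ * T₁       ≡⟨ cong₂ (λ u v → u * v * T₁ * T₁) (÷?-*-cancel T₀>0) (÷?-*-cancel T₂>0) ⟩
    T₁ * T₃ * T₁ * T₁                     ≡⟨ regroup₂ T₁ T₃ ⟩
    T₁ * T₁ * T₁ * T₃                     ≤⟨ cubic ⟩
    T₂ * T₂ * T₂ * T₀                     ≡⟨ regroup₃ T₀ T₂ ⟩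
    T₀ * T₂ * (T₂ * T₂)                   ≡⟨ cong (λ u → T₀ * T₂ * (u * u)) (÷?-*-cancel T₁>0) ⟨
    T₀ * T₂ * ((r₁ * T₁) * (r₁ * T₁))     ≡⟨ regroup₄ T₀ T₁ T₂ r₁ ⟩
    T₀ * T₂ * (T₁ * T₁) * (r₁ * r₁)       ∎)
  where
  open ≤-Reasoning
  T₀ = x n
  T₁ = x (1 ℕ.+ n)
  T₂ = x (2 ℕ.+ n)
  T₃ = x (3 ℕ.+ n)
  r₀ = T₁ ÷? T₀
  r₁ = T₂ ÷? T₁
  r₂ = T₃ ÷? T₂
  regroup₁ : ∀ a b c p q → a * c * (b * b) * (p * q) ≡ (p * a) * (q * c) * b * b
  regroup₁ = solve-∀ ℚ-ring
  regroup₂ : ∀ a b → a * b * a * a ≡ a * a * a * b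
  regroup₂ = solve-∀ ℚ-ring
  regroup₃ : ∀ a c → c * c * c * a ≡ a * c * (c * c)
  regroup₃ = solve-∀ ℚ-ring
  regroup₄ : ∀ a b c p → a * c * ((p * b) * (p * b)) ≡ a * c * (b * b) * (p * p)
  regroup₄ = solve-∀ ℚ-ring

-- The induction step for strict log-concavity of xₙ^{1/n}, with X, Y, Z, W = xₙ₋₁, …, xₙ₊₂,
-- e = n(n+1), f = (n-1)n, g = 2(n-1)(n+1) and e′, g′ the values of e, g at n+1: multiply
-- the e-th power of the cubic inequality by the inequality at n.
root-log-concave-step : ∀ {X Y Z W} (e f g e′ g′ : ℕ) →
  0ℚ ≤ Y → 0ℚ < Z → 0ℚ ≤ W →
  g ℕ.+ e′ ≡ e ℕ.+ e ℕ.+ e → e ℕ.+ e ℕ.+ e ≡ g′ ℕ.+ f →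
  X ^ℚ e * Z ^ℚ f < Y ^ℚ g →
  Y * Y * Y * W ≤ Z * Z * Z * X →
  Y ^ℚ e′ * W ^ℚ e < Z ^ℚ g′
root-log-concave-step {X} {Y} {Z} {W} e f g e′ g′ Y≥0 Z>0 W≥0 exponents₁ exponents₂ root cubic =
  *-cancelˡ-<-nonNeg′ (*-nonNeg (^ℚ-nonNeg g Y≥0) (^ℚ-nonNeg f (<⇒≤ Z>0))) (begin-strict
    Y ^ℚ g * Z ^ℚ f * (Y ^ℚ e′ * W ^ℚ e)     ≡⟨ regroup₁ (Y ^ℚ g) (Z ^ℚ f) (Y ^ℚ e′) (W ^ℚ e) ⟩
    Y ^ℚ g * Y ^ℚ e′ * W ^ℚ e * Z ^ℚ f       ≡⟨ cong (λ u → u * W ^ℚ e * Z ^ℚ f) (^ℚ-+ Y g e′) ⟨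
    Y ^ℚ (g ℕ.+ e′) * W ^ℚ e * Z ^ℚ f        ≡⟨ cong (λ n → Y ^ℚ n * W ^ℚ e * Z ^ℚ f) exponents₁ ⟩
    Y ^ℚ (e ℕ.+ e ℕ.+ e) * W ^ℚ e * Z ^ℚ f   ≡⟨ cong (_* Z ^ℚ f) (^ℚ-cube-* Y W e) ⟨
    (Y * Y * Y * W) ^ℚ e * Z ^ℚ f            ≤⟨ *-monoʳ-≤-nonNeg′ (^ℚ-nonNeg f (<⇒≤ Z>0)) (^ℚ-mono-≤ e Y³W≥0 cubic) ⟩
    (Z * Z * Z * X) ^ℚ e * Z ^ℚ f            ≡⟨ cong (_* Z ^ℚ f) (^ℚ-cube-* Z X e) ⟩
    Z ^ℚ (e ℕ.+ e ℕ.+ e) * X ^ℚ e * Z ^ℚ f   ≡⟨ *-assoc (Z ^ℚ (e ℕ.+ e ℕ.+ e)) (X ^ℚ e) (Z ^ℚ f) ⟩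
    Z ^ℚ (e ℕ.+ e ℕ.+ e) * (X ^ℚ e * Z ^ℚ f) <⟨ *-monoʳ-<-pos′ (^ℚ-pos (e ℕ.+ e ℕ.+ e) Z>0) root ⟩
    Z ^ℚ (e ℕ.+ e ℕ.+ e) * Y ^ℚ g            ≡⟨ cong (λ n → Z ^ℚ n * Y ^ℚ g) exponents₂ ⟩
    Z ^ℚ (g′ ℕ.+ f) * Y ^ℚ g                 ≡⟨ cong (_* Y ^ℚ g) (^ℚ-+ Z g′ f) ⟩
    Z ^ℚ g′ * Z ^ℚ f * Y ^ℚ g                ≡⟨ regroup₂ (Z ^ℚ g′) (Z ^ℚ f) (Y ^ℚ g) ⟩
    Y ^ℚ g * Z ^ℚ f * Z ^ℚ g′                ∎)
  where
  open ≤-Reasoning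
  Y³W≥0 = *-nonNeg (*-nonNeg (*-nonNeg Y≥0 Y≥0) Y≥0) W≥0
  regroup₁ : ∀ a b c d → a * b * (c * d) ≡ a * c * d * b
  regroup₁ = solve-∀ ℚ-ring
  regroup₂ : ∀ a b c → a * b * c ≡ c * b * a
  regroup₂ = solve-∀ ℚ-ring

t-recurrence : ∀ m → ι (3 ℕ.+ m) * t (2 ℕ.+ m) + ι (5 ℕ.* m) * t m ≡ ι (3 ℕ.* (2 ℕ.* m ℕ.+ 3)) * t (1 ℕ.+ m)
t-recurrence m = begin
  P * ((S * t (1 ℕ.+ m) - Q * t m) * (+ 1 / (3 ℕ.+ m))) + Q * t m ≡⟨ cong (_+ Q * t m) (swap P (S * t (1 ℕ.+ m) - Q * t m) _) ⟩
  (S * t (1 ℕ.+ m) - Q * t m) * (P * (+ 1 / (3 ℕ.+ m))) + Q * t m ≡⟨ cong (λ u → (S * t (1 ℕ.+ m) - Q * t m) * u + Q * t m) (ι-inverse (2 ℕ.+ m)) ⟩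
  (S * t (1 ℕ.+ m) - Q * t m) * 1ℚ + Q * t m                      ≡⟨ cancel (S * t (1 ℕ.+ m)) (Q * t m) ⟩
  S * t (1 ℕ.+ m)                                                 ∎
  where
  open ≡-Reasoning
  P = ι (3 ℕ.+ m)
  Q = ι (5 ℕ.* m)
  S = ι (3 ℕ.* (2 ℕ.* m ℕ.+ 3))
  swap : ∀ a b c → a * (b * c) ≡ b * (a * c)
  swap = solve-∀ ℚ-ring
  cancel : ∀ x y → (x - y) * 1ℚ + y ≡ x
  cancel = solve-∀ ℚ-ring

t-positive : ∀ n → 0ℚ < t n
t-nondecreasing : ∀ n → t n ≤ t (suc n)

t-positive zero    = positive⁻¹ 1ℚ
t-positive (suc n) = <-≤-trans (t-positive n) (t-nondecreasing n)

t-nondecreasing zero    = ≤-refl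
t-nondecreasing (suc m) = *-cancelˡ-≤-pos′ (positive⁻¹ 1ℚ)
  (ratio-lower-step {S = ι (3 ℕ.* (2 ℕ.* m ℕ.+ 3))} {T₀ = t m}
     (t-recurrence m) (ι-pos (3 ℕ.+ m) (s≤s z≤n)) (ι-nonNeg (5 ℕ.* m)) (<⇒≤ (t-positive (suc m)))
     {A = 1ℚ} {B = 1ℚ} {G = 1ℚ} {D = 1ℚ} (positive⁻¹ 1ℚ) (nonNegative⁻¹ 1ℚ)
     (≤-by-coefficients (cast (con 3 :+ var) :* con 1 :* con 1 :+ con 1 :* cast (con 5 :* var) :* con 1)
                        (con 1 :* con 1 :* cast (con 3 :* (con 2 :* var :+ con 3))) m)
     (*-monoˡ-≤-nonNeg′ (nonNegative⁻¹ 1ℚ) (t-nondecreasing m)))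

-- With n = k + 15: a(k) / d(k) = 5 - 15/(2n) + 255/(16n²) - 495/(16n³) and
-- b(k) / d(k) = a(k) / d(k) + 80/n⁴.
aₚ bₚ dₚ : Poly
aₚ = 3694950 ∷ 1006155 ∷ 102855 ∷ 4680 ∷ 80 ∷ []
bₚ = 3696230 ∷ 1006155 ∷ 102855 ∷ 4680 ∷ 80 ∷ []
dₚ = 810000 ∷ 216000 ∷ 21600 ∷ 960 ∷ 16 ∷ []

a b d : ℕ → ℕ
a = eval aₚ
b = eval bₚ
d = eval dₚ

module t-RatioBounds = RatioBoundPropagation t
  (λ m → ι (3 ℕ.+ m)) (λ m → ι (5 ℕ.* m)) (λ m → ι (3 ℕ.* (2 ℕ.* m ℕ.+ 3))) t-recurrence
  (λ m → ι-pos (3 ℕ.+ m) (s≤s z≤n)) (λ m → ι-nonNeg (5 ℕ.* m)) 15 (λ k → <⇒≤ (t-positive (k ℕ.+ 15)))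

lower-certificate : ∀ k → let m = k ℕ.+ 15 in
  ι (3 ℕ.+ m) * ι (a k) * ι (a (suc k)) + ι (d (suc k)) * ι (5 ℕ.* m) * ι (d k)
    ≤ ι (d (suc k)) * ι (a k) * ι (3 ℕ.* (2 ℕ.* m ℕ.+ 3))
lower-certificate = ≤-by-coefficients
  (cast (con 3 :+ m) :* poly aₚ var :* poly aₚ (con 1 :+ var) :+ poly dₚ (con 1 :+ var) :* cast (con 5 :* m) :* poly dₚ var)
  (poly dₚ (con 1 :+ var) :* poly aₚ var :* cast (con 3 :* (con 2 :* m :+ con 3)))
  where m = var :+ con 15

upper-certificate : ∀ k → let m = k ℕ.+ 15 in
  ι (d (suc k)) * ι (b k) * ι (3 ℕ.* (2 ℕ.* m ℕ.+ 3))
    ≤ ι (3 ℕ.+ m) * ι (b k) * ι (b (suc k)) + ι (d (suc k)) * ι (5 ℕ.* m) * ι (d k)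
upper-certificate = ≤-by-coefficients
  (poly dₚ (con 1 :+ var) :* poly bₚ var :* cast (con 3 :* (con 2 :* m :+ con 3)))
  (cast (con 3 :+ m) :* poly bₚ var :* poly bₚ (con 1 :+ var) :+ poly dₚ (con 1 :+ var) :* cast (con 5 :* m) :* poly dₚ var)
  where m = var :+ con 15

log-concavity-certificate : ∀ k →
  ι (b k) * ι (b (2 ℕ.+ k)) * (ι (d (1 ℕ.+ k)) * ι (d (1 ℕ.+ k)))
    ≤ ι (a (1 ℕ.+ k)) * ι (a (1 ℕ.+ k)) * (ι (d k) * ι (d (2 ℕ.+ k)))
log-concavity-certificate = ≤-by-coefficients
  (poly bₚ var :* poly bₚ (con 2 :+ var) :* (poly dₚ (con 1 :+ var) :* poly dₚ (con 1 :+ var)))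
  (poly aₚ (con 1 :+ var) :* poly aₚ (con 1 :+ var) :* (poly dₚ var :* poly dₚ (con 2 :+ var)))

opaque
  unfolding eval
  t-ratio-bounds-at-15 : ι (a 0) * t 15 ≤ ι (d 0) * t 16 × ι (d 0) * t 16 ≤ ι (b 0) * t 15
  t-ratio-bounds-at-15 = ≤-by-computation , ≤-by-computation

t-ratio-lower-bound : ∀ k → ι (a k) * t (k ℕ.+ 15) ≤ ι (d k) * t (suc k ℕ.+ 15)
t-ratio-lower-bound = t-RatioBounds.ratio-lower-bound (λ k → ι (a k)) (λ k → ι (d k))
  (λ k → ι-pos (a k) (eval-pos _ _ k)) (λ k → ι-nonNeg (d k)) lower-certificate (proj₁ t-ratio-bounds-at-15)

t-ratio-upper-bound : ∀ k → ι (d k) * t (suc k ℕ.+ 15) ≤ ι (b k) * t (k ℕ.+ 15)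
t-ratio-upper-bound = t-RatioBounds.ratio-upper-bound (λ k → ι (b k)) (λ k → ι (d k))
  (λ k → ι-pos (b k) (eval-pos _ _ k)) (λ k → ι-nonNeg (d k)) upper-certificate (proj₂ t-ratio-bounds-at-15)

t-ratio-log-concave-from-15 : ∀ k → RatioLogConcaveAt t (k ℕ.+ 15)
t-ratio-log-concave-from-15 = ratio-log-concave-from-bounds t (λ k → ι (a k)) (λ k → ι (b k)) (λ k → ι (d k)) 15
  (λ k → <⇒≤ (t-positive (k ℕ.+ 15))) (λ k → ι-pos (a k) (eval-pos _ _ k)) (λ k → ι-pos (d k) (eval-pos _ _ k))
  t-ratio-lower-bound t-ratio-upper-bound log-concavity-certificate

t-ratio-log-concave-below-15 : ∀ {n} → n ℕ.< 15 → RatioLogConcaveAt t n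
t-ratio-log-concave-below-15 = from-yes (ℕ.allUpTo? {P = RatioLogConcaveAt t} (λ n → _ ≤? _) 15)

t-ratio-log-concave : ∀ n → RatioLogConcaveAt t n
t-ratio-log-concave n with n ℕ.<? 15
... | yes n<15 = t-ratio-log-concave-below-15 n<15
... | no  n≮15 = subst (RatioLogConcaveAt t) (ℕ.m∸n+n≡m (ℕ.≮⇒≥ n≮15)) (t-ratio-log-concave-from-15 (n ℕ.∸ 15))

t-root-log-concave : ∀ j →
  t (1 ℕ.+ j) ^ℚ ((2 ℕ.+ j) ℕ.* (3 ℕ.+ j)) * t (3 ℕ.+ j) ^ℚ ((1 ℕ.+ j) ℕ.* (2 ℕ.+ j))
    < t (2 ℕ.+ j) ^ℚ (2 ℕ.* ((1 ℕ.+ j) ℕ.* (3 ℕ.+ j)))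
t-root-log-concave zero    = <-by-computation
t-root-log-concave (suc j) = root-log-concave-step {X = t (1 ℕ.+ j)}
  ((2 ℕ.+ j) ℕ.* (3 ℕ.+ j)) ((1 ℕ.+ j) ℕ.* (2 ℕ.+ j)) (2 ℕ.* ((1 ℕ.+ j) ℕ.* (3 ℕ.+ j)))
  ((3 ℕ.+ j) ℕ.* (4 ℕ.+ j)) (2 ℕ.* ((2 ℕ.+ j) ℕ.* (4 ℕ.+ j)))
  (<⇒≤ (t-positive (2 ℕ.+ j))) (t-positive (3 ℕ.+ j)) (<⇒≤ (t-positive (4 ℕ.+ j)))
  (exponents₁ j) (exponents₂ j) (t-root-log-concave j) (t-ratio-log-concave (1 ℕ.+ j))
  where
  exponents₁ : ∀ j → 2 ℕ.* ((1 ℕ.+ j) ℕ.* (3 ℕ.+ j)) ℕ.+ (3 ℕ.+ j) ℕ.* (4 ℕ.+ j)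
                     ≡ (2 ℕ.+ j) ℕ.* (3 ℕ.+ j) ℕ.+ (2 ℕ.+ j) ℕ.* (3 ℕ.+ j) ℕ.+ (2 ℕ.+ j) ℕ.* (3 ℕ.+ j)
  exponents₁ = ℕ-Ring.solve-∀
  exponents₂ : ∀ j → (2 ℕ.+ j) ℕ.* (3 ℕ.+ j) ℕ.+ (2 ℕ.+ j) ℕ.* (3 ℕ.+ j) ℕ.+ (2 ℕ.+ j) ℕ.* (3 ℕ.+ j)
                     ≡ 2 ℕ.* ((2 ℕ.+ j) ℕ.* (4 ℕ.+ j)) ℕ.+ (1 ℕ.+ j) ℕ.* (2 ℕ.+ j)
  exponents₂ = ℕ-Ring.solve-∀

theorem4p8 : RatioLogConcave-from 2 t × RootStrictlyLogConcave-from1 t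
theorem4p8 =
  ( (λ n _ → t-positive n)
  , (λ n _ → ÷?-pos (t-positive (suc n)) (t-positive n))
  , λ { zero () ; (suc n) _ → ratio-log-concave-from-cubic t n
                                (t-positive n) (t-positive (1 ℕ.+ n)) (t-positive (2 ℕ.+ n))
                                (t-ratio-log-concave n) } )
  , (λ n _ → t-positive n)
  , λ { zero () ; (suc zero) (s≤s ()) ; (suc (suc j)) _ → t-root-log-concave j }
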